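{- Let $k\ge1$, $c\ge 2$ and $q\ge ck+1$ be integers, and let $\alpha=\frac{c-1}{c}$. If $G$ is a graph such that for every set $X\subseteq V(G)$ of size exactly $q$, $G$ has an $\alpha$-balanced separation for $X$ of order at most $k$, then $\mathrm{tw}(G)\le q+k-1$.
   Context: A separation of a graph $G$ is a pair $(A,B)$ of subsets of $V(G)$ with $A\cup B=V(G)$ such that no edge has one end in $A\setminus B$ and the other in $B\setminus A$; its order is $|A\cap B|$. For $X\subseteq V(G)$, $(A,B)$ is $\alpha$-balanced for $X$ if $|X\cap(A\setminus B)|\le\alpha|X|$ and $|X\cap(B\setminus A)|\le\alpha|X|$. $\mathrm{tw}$ denotes treewidth. -}

module Defs where

open import Level using (0ℓ)
open import Data.Nat using (ℕ; suc; _+_; _*_; _∸_; _≤_)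
open import Data.Fin using (Fin)
open import Data.Fin.Subset using (Subset; _∈_; _∉_; _∩_; _─_; ∣_∣)
open import Data.List using (List; _∷_; length; _∷ʳ_)
open import Data.List.Relation.Unary.Linked using (Linked)
open import Data.List.Relation.Unary.Unique.Propositional using (Unique)
open import Data.Product using (Σ; _×_; ∃)
open import Data.Sum using (_⊎_)
open import Relation.Nullary using (¬_)

record Graph (n : ℕ) : Set₁ where
  field
    Adj     : Fin n → Fin n → Set
    symAdj  : ∀ {u v} → Adj u v → Adj v u
    irrefl  : ∀ {v} → ¬ Adj v v
open Graph public

data PathIn {n : ℕ} (G : Graph n) (P : Fin n → Set) : Fin n → Fin n → Set where
  here : ∀ {x} → P x → PathIn G P x x
  step : ∀ {x y z} → P x → Adj G x y → PathIn G P y z → PathIn G P x z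

InducedConnected : {n : ℕ} → Graph n → (Fin n → Set) → Set
InducedConnected G P = ∀ x y → P x → P y → PathIn G P x y

Connected : {n : ℕ} → Graph n → Set
Connected G = InducedConnected G (λ _ → Data.Unit.⊤)
  where import Data.Unit

HasCycle : {n : ℕ} → Graph n → Set
HasCycle {n} G = Σ (Fin n) λ v → Σ (List (Fin n)) λ ys →
  (2 ≤ length ys) × Unique (v ∷ ys) × Linked (Adj G) ((v ∷ ys) ∷ʳ v)

IsTree : {m : ℕ} → Graph m → Set
IsTree {m} T = (1 ≤ m) × Connected T × ¬ HasCycle T

record TreeDecomposition {n : ℕ} (G : Graph n) (w : ℕ) : Set₁ where
  field
    m        : ℕ
    T        : Graph m
    isTree   : IsTree T
    bag      : Fin m → Subset n
    covers   : ∀ v → ∃ λ t → v ∈ bag t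
    edges    : ∀ u v → Adj G u v → ∃ λ t → (u ∈ bag t) × (v ∈ bag t)
    subtree  : ∀ v → InducedConnected T (λ t → v ∈ bag t)
    width    : ∀ t → ∣ bag t ∣ ≤ suc w

TwAtMost : {n : ℕ} → Graph n → ℕ → Set₁
TwAtMost G w = TreeDecomposition G w

record IsSeparation {n : ℕ} (G : Graph n) (A B : Subset n) : Set where
  field
    cover    : ∀ v → (v ∈ A) ⊎ (v ∈ B)
    noEdge   : ∀ u v → u ∈ A ─ B → v ∈ B ─ A → ¬ Adj G u v

order : {n : ℕ} → Subset n → Subset n → ℕ
order A B = ∣ A ∩ B ∣

-- (A, B) is α-balanced for X with α = (c-1)/c, i.e. |X ∩ (A∖B)| ≤ ((c-1)/c)|X|,
-- written multiplied through by c > 0.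
Balanced : {n : ℕ} → ℕ → Subset n → Subset n → Subset n → Set
Balanced c X A B =
  (c * ∣ X ∩ (A ─ B) ∣ ≤ (c ∸ 1) * ∣ X ∣) × (c * ∣ X ∩ (B ─ A) ∣ ≤ (c ∸ 1) * ∣ X ∣)

-- Call a rooted tree decomposition of G[U] with bags of at most q + k vertices whose root bag
-- contains S a decomposition of U anchored at S. Every U ⊇ S with |S| < q has one, by induction
-- on |U ∖ S|. If |U| ≤ q + k, one bag suffices. Otherwise enlarge S to X ⊆ U with |X| = q, take a
-- balanced separation (A, B) for X of order at most k, use R = X ∪ (U ∩ A ∩ B) as root bag
-- (|R| ≤ q + k), and hang below it decompositions of U ∩ A and of U ∩ B anchored at their
-- intersections with R. The anchor on the A side lies in (X ∩ (A ∖ B)) ∪ (A ∩ B), so it has at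
-- most (c − 1)q/c + k < q vertices because q ≥ ck + 1; the same holds on the B side. Since
-- R ⊇ X ⊋ S, the induction measure drops. For U = V(G) and S = ∅ this is a tree decomposition
-- of width at most q + k − 1.

module Submission where

open import Defs
open import Data.Nat using (ℕ; zero; suc; _+_; _*_; _∸_; _≤_; _<_; _≤?_; z≤n; s≤s)
open import Data.Nat.Properties
  using ( *-cancelˡ-<; *-distribˡ-+; *-monoʳ-≤; +-comm; +-mono-≤; +-monoʳ-<; +-suc; <-asym
        ; <-irrefl; <-trans; <⇒≤; m≤m+n; m≤n+m; m≤n+m∸n; n≤1+n; ≤-<-trans; ≤-antisym
        ; ≤-reflexive; ≤-trans; ≰⇒>; module ≤-Reasoning )
open import Data.Nat.Induction using (<-wellFounded)
open import Induction.WellFounded using (Acc; acc)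
open import Data.Fin using (Fin; zero; suc)
open import Data.Fin.Properties using (toℕ<n; +↔⊎; 1↔⊤)
open import Data.Fin.Subset using (Subset; outside; inside; _∈_; _∉_; _⊆_; _∩_; _∪_; _─_; ∣_∣; ⊤; ⊥)
open import Data.Fin.Subset.Properties
  using ( _∈?_; drop-there; drop-∷-⊆; out⊆; s⊆s; ⊆-refl; ⊆-trans; ⊆-min; ∈⊤; ∣⊥∣≡0; ∣p∣≤∣x∷p∣
        ; p⊆q⇒∣p∣≤∣q∣; p⊂q⇒∣p∣<∣q∣; p∩q⊆p; p∩q⊆q; ∣p∩q∣≤∣q∣; p⊆p∪q; q⊆p∪q; p─q⊆p
        ; x∈p∩q⁺; x∈p∩q⁻; x∈p∪q⁺; x∈p∪q⁻; x∈p∧x∉q⇒x∈p─q )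
open import Data.Vec using ([]; _∷_; here; there)
open import Data.Maybe as Maybe using (Maybe; just; nothing; maybe)
open import Data.Maybe.Properties using (just-injective; map-just)
open import Data.List using (List; []; _∷_; _∷ʳ_)
open import Data.List.Membership.Propositional using () renaming (_∈_ to _∈ₗ_)
open import Data.List.Relation.Unary.Any as Any using ()
open import Data.List.Relation.Unary.All as All using (_∷_)
open import Data.List.Relation.Unary.AllPairs using (_∷_)
open import Data.List.Relation.Unary.Linked as Linked using (Linked; [-]; _∷_)
open import Data.List.Relation.Unary.Unique.Propositional using (Unique)
open import Data.Product as Product using (Σ; _×_; _,_; proj₁; proj₂; ∃)
open import Data.Sum as Sum using (_⊎_; inj₁; inj₂; [_,_]′; fromInj₂)
open import Data.Sum.Function.Propositional using (_⊎-↔_)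
open import Data.Unit using (tt) renaming (⊤ to Unit)
open import Data.Empty using (⊥-elim) renaming (⊥ to Empty)
open import Function using (_∘_; _$_; id; flip)
open import Function.Bundles using (_↔_; Inverse)
open import Function.Properties.Inverse using (↔-trans)
open import Relation.Nullary using (¬_; yes; no; contradiction)
open import Relation.Binary.PropositionalEquality using (_≡_; refl; sym; trans; cong; subst)

module _ {n : ℕ} {G : Graph n} {P : Fin n → Set} where

  pathIn-source : ∀ {x y} → PathIn G P x y → P x
  pathIn-source (here Px)     = Px
  pathIn-source (step Px _ _) = Px

  infixr 5 _++ₚ_
  _++ₚ_ : ∀ {x y z} → PathIn G P x y → PathIn G P y z → PathIn G P x z
  here _       ++ₚ π = π
  step Px xy ρ ++ₚ π = step Px xy (ρ ++ₚ π)

  reverseₚ : ∀ {x y} → PathIn G P x y → PathIn G P y x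
  reverseₚ (here Px)      = here Px
  reverseₚ (step Px xy π) = reverseₚ π ++ₚ step (pathIn-source π) (symAdj G xy) (here Px)

module _ {A : Set} where

  last : A → List A → A
  last x []      = x
  last x (y ∷ r) = last y r

  last∈ : ∀ x r → last x r ∈ₗ x ∷ r
  last∈ x []      = Any.here refl
  last∈ x (y ∷ r) = Any.there (last∈ y r)

  FinalStep : (A → A → Set) → A → A → List A → Set
  FinalStep R x y []      = R x y
  FinalStep R x y (z ∷ r) = FinalStep R y z r

  module _ {R : A → A → Set} where

    linked⇒finalStep : ∀ {x y} r → Linked R (x ∷ y ∷ r) → FinalStep R x y r
    linked⇒finalStep []      (xy ∷ _)     = xy
    linked⇒finalStep (z ∷ r) (_ ∷ links) = linked⇒finalStep r links

    finalStep-penultimate : ∀ {x y} r → FinalStep R x y r →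
                            ∃ λ p → p ∈ₗ x ∷ y ∷ r × R p (last y r)
    finalStep-penultimate []      xy  = _ , Any.here refl , xy
    finalStep-penultimate (z ∷ r) fin =
      Product.map₂ (Product.map₁ Any.there) (finalStep-penultimate r fin)

    linked-∷ʳ⁻ : ∀ x r {w} → Linked R ((x ∷ r) ∷ʳ w) → Linked R (x ∷ r) × R (last x r) w
    linked-∷ʳ⁻ x []      (xw ∷ _)    = [-] , xw
    linked-∷ʳ⁻ x (y ∷ r) (xy ∷ rest) = Product.map₁ (xy ∷_) (linked-∷ʳ⁻ y r rest)

  finalStep-⊎ : ∀ {R S : A → A → Set} {x y} r →
                FinalStep (λ a b → R a b ⊎ S a b) x y r → FinalStep R x y r ⊎ FinalStep S x y r
  finalStep-⊎ []      xy  = xy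
  finalStep-⊎ (z ∷ r) fin = finalStep-⊎ r fin

module Parents {N : Set} (parent : N → Maybe N) where

  infix 4 _↑_ _↓_
  _↑_ _↓_ : N → N → Set
  t ↑ p = parent t ≡ just p
  p ↓ t = t ↑ p

  ↑-functional : ∀ {t p p′} → t ↑ p → t ↑ p′ → p ≡ p′
  ↑-functional t↑p t↑p′ = just-injective (trans (sym t↑p) t↑p′)

  ClosedUpTo : (N → Set) → N → Set
  ClosedUpTo P top = ∀ t → P t → t ≡ top ⊎ ∃ λ p → t ↑ p × P p

module ParentPointerTree {m : ℕ} (parent : Fin m → Maybe (Fin m)) (rank : Fin m → ℕ)
  (rank-parent : ∀ {t p} → parent t ≡ just p → rank p < rank t) where

  open Parents parent public

  Link : Fin m → Fin m → Set
  Link s t = s ↑ t ⊎ t ↑ s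

  ↑-irrefl : ∀ {t} → ¬ t ↑ t
  ↑-irrefl t↑t = <-irrefl refl (rank-parent t↑t)

  tree : Graph m
  tree = record { Adj = Link ; symAdj = Sum.swap ; irrefl = Sum.[ ↑-irrefl , ↑-irrefl ] }

  module _ {P : Fin m → Set} {top : Fin m} (closed : ClosedUpTo P top) where

    path-to-top : ∀ {t} → Acc _<_ (rank t) → P t → PathIn tree P t top
    path-to-top {t} (acc rec) Pt with closed t Pt
    ... | inj₁ refl           = here Pt
    ... | inj₂ (p , t↑p , Pp) = step Pt (inj₁ t↑p) (path-to-top (rec (rank-parent t↑p)) Pp)

    closedUpTo⇒connected : InducedConnected tree P
    closedUpTo⇒connected x y Px Py =
      path-to-top (<-wellFounded _) Px ++ₚ reverseₚ (path-to-top (<-wellFounded _) Py)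

  -- Stepping up right after stepping down would revisit a vertex.
  descends : ∀ {x y} r → Unique (x ∷ y ∷ r) → Linked Link (x ∷ y ∷ r) → x ↓ y →
             rank x < rank (last y r) × FinalStep _↓_ x y r
  descends []      _                    _                      x↓y = rank-parent x↓y , x↓y
  descends (z ∷ r) ((_ ∷ x≢z ∷ _) ∷ _) (_ ∷ inj₁ y↑z ∷ _)     x↓y =
    ⊥-elim (x≢z (↑-functional x↓y y↑z))
  descends (z ∷ r) (_ ∷ uniq)           (_ ∷ inj₂ y↓z ∷ links) x↓y =
    Product.map₁ (<-trans (rank-parent x↓y)) (descends r uniq (inj₂ y↓z ∷ links) y↓z)

  finalStep-↑↓-absurd : ∀ {x y} r → FinalStep _↑_ x y r → FinalStep _↓_ x y r → Empty
  finalStep-↑↓-absurd []      x↑y x↓y = <-asym (rank-parent x↑y) (rank-parent x↓y)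
  finalStep-↑↓-absurd (z ∷ r) up  down = finalStep-↑↓-absurd r up down

  ascends : ∀ {x y} r → Unique (x ∷ y ∷ r) → Linked Link (x ∷ y ∷ r) → FinalStep _↑_ x y r →
            rank (last y r) < rank x
  ascends []      _          _                      x↑y = rank-parent x↑y
  ascends (z ∷ r) (_ ∷ uniq) (inj₁ x↑y ∷ links)     up  =
    <-trans (ascends r uniq links up) (rank-parent x↑y)
  ascends (z ∷ r) uniq       links@(inj₂ x↓y ∷ _) up  =
    ⊥-elim (finalStep-↑↓-absurd r up (proj₂ (descends (z ∷ r) uniq links x↓y)))

  -- Let ℓ be the vertex closing the cycle v, y, …, ℓ, v. If ℓ is the parent of v, the walk
  -- v, y, …, ℓ can neither start upwards (v has one parent) nor downwards (it would end below v).
  -- If v is the parent of ℓ, the walk can neither end downwards (ℓ has one parent) nor upwards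
  -- (it would have gone up all the way, ending above v).
  acyclic : ¬ HasCycle tree
  acyclic (v , []        , ()     , _)
  acyclic (v , _ ∷ []    , s≤s () , _)
  acyclic (v , y ∷ z ∷ r , _ , uniq@(v∉ ∷ y∉ ∷ _) , cycle)
    with linked-∷ʳ⁻ v (y ∷ z ∷ r) cycle
  ... | walk , inj₂ v↑ℓ with Linked.head walk
  ...   | inj₁ v↑y = All.lookup y∉ (last∈ z r) (↑-functional v↑y v↑ℓ)
  ...   | inj₂ v↓y = <-asym (rank-parent v↑ℓ) (proj₁ (descends (z ∷ r) uniq walk v↓y))
  acyclic (v , y ∷ z ∷ r , _ , uniq@(v∉ ∷ y∉ ∷ _) , cycle)
      | walk , inj₁ ℓ↑v
    with finalStep-⊎ {R = _↑_} {S = _↓_} r (linked⇒finalStep (z ∷ r) walk)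
  ...   | inj₁ up   = <-asym (rank-parent ℓ↑v) (ascends (z ∷ r) uniq walk up)
  ...   | inj₂ down with finalStep-penultimate r down
  ...     | p , p∈ , ℓ↑p = All.lookup v∉ p∈ (↑-functional ℓ↑v ℓ↑p)

  module _ (root : Fin m) (orphan⇒root : ∀ {t} → parent t ≡ nothing → t ≡ root) where

    all-closedUpTo-root : ClosedUpTo (λ _ → Unit) root
    all-closedUpTo-root t _ with parent t in t↑
    ... | nothing = inj₁ (orphan⇒root t↑)
    ... | just p  = inj₂ (p , refl , tt)

    isTree : IsTree tree
    isTree = ≤-trans (s≤s z≤n) (toℕ<n root) , closedUpTo⇒connected all-closedUpTo-root , acyclic

-- Nodes range over an arbitrary type so that trees can be joined by disjoint union;
-- enumeration relabels them by Fin size, which is what Graph requires.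
record RootedTree : Set₁ where
  field
    Node        : Set
    size        : ℕ
    enumeration : Fin size ↔ Node
    root        : Node
    parent      : Node → Maybe Node
    rank        : Node → ℕ
    rank-parent : ∀ {t p} → parent t ≡ just p → rank p < rank t
    parent-root : parent root ≡ nothing
    orphan⇒root : ∀ {t} → parent t ≡ nothing → t ≡ root

  open Parents parent public
  open Inverse enumeration using (to; from; strictlyInverseˡ; strictlyInverseʳ)

  Subtree : (Node → Set) → Set
  Subtree P = ∃ (ClosedUpTo P)

  closedUpTo-root : ∀ {P top} → ClosedUpTo P top → (∀ {t} → P t → P root) → ClosedUpTo P root
  closedUpTo-root closed P⇒Proot t Pt with closed t Pt
  ... | inj₂ up    = inj₂ up
  ... | inj₁ refl with closed root (P⇒Proot Pt)
  ...   | inj₁ refl             = inj₁ refl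
  ...   | inj₂ (_ , root↑ , _) with () ← trans (sym parent-root) root↑

  private
    parentᶠ : Fin size → Maybe (Fin size)
    parentᶠ i = Maybe.map from (parent (to i))

    parentᶠ-just : ∀ {i j} → parentᶠ i ≡ just j → to i ↑ to j
    parentᶠ-just {i} i↑j with parent (to i)
    ... | just p = cong just (trans (sym (strictlyInverseˡ p)) (cong to (just-injective i↑j)))

    orphanᶠ⇒root : ∀ {i} → parentᶠ i ≡ nothing → i ≡ from root
    orphanᶠ⇒root {i} orphan with parent (to i) in i↑
    ... | nothing = trans (sym (strictlyInverseʳ i)) (cong from (orphan⇒root i↑))

    module FinTree = ParentPointerTree parentᶠ (rank ∘ to) (rank-parent ∘ parentᶠ-just)

    at-index : ∀ {P : Node → Set} {t} → P t → P (to (from t))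
    at-index {P} {t} = subst P (sym (strictlyInverseˡ t))

  graph : Graph size
  graph = FinTree.tree

  graph-isTree : IsTree graph
  graph-isTree = FinTree.isTree (from root) orphanᶠ⇒root

  index : ∀ {P : Node → Set} → ∃ P → ∃ (P ∘ to)
  index {P} (t , Pt) = from t , at-index {P} Pt

  subtree⇒connected : ∀ {P} → Subtree P → InducedConnected graph (P ∘ to)
  subtree⇒connected {P} (top , closed) = FinTree.closedUpTo⇒connected closedᶠ
    where
    closedᶠ : FinTree.ClosedUpTo (P ∘ to) (from top)
    closedᶠ i Pi with closed (to i) Pi
    ... | inj₁ i≡top          = inj₁ (trans (sym (strictlyInverseʳ i)) (cong from i≡top))
    ... | inj₂ (p , i↑p , Pp) = inj₂ (from p , map-just i↑p , at-index {P} Pp)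

point : RootedTree
point = record
  { Node = Unit ; size = 1 ; enumeration = 1↔⊤ ; root = tt
  ; parent = λ _ → nothing ; rank = λ _ → 0 ; rank-parent = λ ()
  ; parent-root = refl ; orphan⇒root = λ _ → refl }

pattern apex  = inj₁ tt
pattern inl t = inj₂ (inj₁ t)
pattern inr t = inj₂ (inj₂ t)

module Join (T₁ T₂ : RootedTree) where
  private
    module T₁ = RootedTree T₁
    module T₂ = RootedTree T₂

  Node : Set
  Node = Unit ⊎ (T₁.Node ⊎ T₂.Node)

  parent : Node → Maybe Node
  parent apex    = nothing
  parent (inl t) = just (maybe inl apex (T₁.parent t))
  parent (inr t) = just (maybe inr apex (T₂.parent t))

  rank : Node → ℕ
  rank apex    = 0
  rank (inl t) = suc (T₁.rank t)
  rank (inr t) = suc (T₂.rank t)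

  rank-parent : ∀ {t p} → parent t ≡ just p → rank p < rank t
  rank-parent {inl t} refl with T₁.parent t in t↑
  ... | nothing = s≤s z≤n
  ... | just _  = s≤s (T₁.rank-parent t↑)
  rank-parent {inr t} refl with T₂.parent t in t↑
  ... | nothing = s≤s z≤n
  ... | just _  = s≤s (T₂.rank-parent t↑)

  orphan⇒apex : ∀ {t} → parent t ≡ nothing → t ≡ apex
  orphan⇒apex {apex}  _  = refl
  orphan⇒apex {inl _} ()
  orphan⇒apex {inr _} ()

  tree : RootedTree
  tree = record
    { Node        = Node
    ; size        = suc (T₁.size + T₂.size)
    ; enumeration = ↔-trans +↔⊎ (1↔⊤ ⊎-↔ ↔-trans +↔⊎ (T₁.enumeration ⊎-↔ T₂.enumeration))
    ; root        = apex
    ; parent      = parent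
    ; rank        = rank
    ; rank-parent = rank-parent
    ; parent-root = refl
    ; orphan⇒root = orphan⇒apex }

  open RootedTree tree using (ClosedUpTo)

  closedUpTo-apex : ∀ {P} → P apex →
                    T₁.ClosedUpTo (P ∘ inl) T₁.root → T₂.ClosedUpTo (P ∘ inr) T₂.root →
                    ClosedUpTo P apex
  closedUpTo-apex _     _       _       apex    _  = inj₁ refl
  closedUpTo-apex Papex closed₁ _       (inl t) Pt with closed₁ t Pt
  ... | inj₁ refl           = inj₂ (apex , cong (just ∘ maybe inl apex) T₁.parent-root , Papex)
  ... | inj₂ (p , t↑p , Pp) = inj₂ (inl p , cong (just ∘ maybe inl apex) t↑p , Pp)
  closedUpTo-apex Papex _       closed₂ (inr t) Pt with closed₂ t Pt
  ... | inj₁ refl           = inj₂ (apex , cong (just ∘ maybe inr apex) T₂.parent-root , Papex)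
  ... | inj₂ (p , t↑p , Pp) = inj₂ (inr p , cong (just ∘ maybe inr apex) t↑p , Pp)

  closedUpTo-inl : ∀ {P top} → ¬ P apex → (∀ t → ¬ P (inr t)) → T₁.ClosedUpTo (P ∘ inl) top →
                   ClosedUpTo P (inl top)
  closedUpTo-inl ¬Papex _     _       apex    Papex = ⊥-elim (¬Papex Papex)
  closedUpTo-inl _      ¬Pinr _       (inr t) Pt    = ⊥-elim (¬Pinr t Pt)
  closedUpTo-inl _      _     closed₁ (inl t) Pt with closed₁ t Pt
  ... | inj₁ refl           = inj₁ refl
  ... | inj₂ (p , t↑p , Pp) = inj₂ (inl p , cong (just ∘ maybe inl apex) t↑p , Pp)

  closedUpTo-inr : ∀ {P top} → ¬ P apex → (∀ t → ¬ P (inl t)) → T₂.ClosedUpTo (P ∘ inr) top →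
                   ClosedUpTo P (inr top)
  closedUpTo-inr ¬Papex _     _       apex    Papex = ⊥-elim (¬Papex Papex)
  closedUpTo-inr _      ¬Pinl _       (inl t) Pt    = ⊥-elim (¬Pinl t Pt)
  closedUpTo-inr _      _     closed₂ (inr t) Pt with closed₂ t Pt
  ... | inj₁ refl           = inj₁ refl
  ... | inj₂ (p , t↑p , Pp) = inj₂ (inr p , cong (just ∘ maybe inr apex) t↑p , Pp)

x∈p─q⇒x∉q : ∀ {n} (p q : Subset n) {x} → x ∈ p ─ q → x ∉ q
x∈p─q⇒x∉q (_ ∷ p) (outside ∷ q) here        ()
x∈p─q⇒x∉q (_ ∷ p) (_ ∷ q)       (there x∈) (there x∈q) = x∈p─q⇒x∉q p q x∈ x∈q

∣p∪q∣≤∣p∣+∣q∣ : ∀ {n} (p q : Subset n) → ∣ p ∪ q ∣ ≤ ∣ p ∣ + ∣ q ∣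
∣p∪q∣≤∣p∣+∣q∣ []            []            = z≤n
∣p∪q∣≤∣p∣+∣q∣ (outside ∷ p) (outside ∷ q) = ∣p∪q∣≤∣p∣+∣q∣ p q
∣p∪q∣≤∣p∣+∣q∣ (inside ∷ p)  (outside ∷ q) = s≤s (∣p∪q∣≤∣p∣+∣q∣ p q)
∣p∪q∣≤∣p∣+∣q∣ (outside ∷ p) (inside ∷ q)  =
  ≤-trans (s≤s (∣p∪q∣≤∣p∣+∣q∣ p q)) (≤-reflexive (sym (+-suc _ _)))
∣p∪q∣≤∣p∣+∣q∣ (inside ∷ p)  (inside ∷ q)  =
  s≤s (≤-trans (∣p∪q∣≤∣p∣+∣q∣ p q) (≤-trans (n≤1+n _) (≤-reflexive (sym (+-suc _ _)))))

∣p∣<∣q∣⇒∃∈q∖p : ∀ {n} (p q : Subset n) → ∣ p ∣ < ∣ q ∣ → ∃ λ x → x ∈ q × x ∉ p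
∣p∣<∣q∣⇒∃∈q∖p (s ∷ p)       (outside ∷ q) lt
  with ∣p∣<∣q∣⇒∃∈q∖p p q (≤-trans (s≤s (∣p∣≤∣x∷p∣ s p)) lt)
... | x , x∈q , x∉p = suc x , there x∈q , x∉p ∘ drop-there
∣p∣<∣q∣⇒∃∈q∖p (outside ∷ p) (inside ∷ q)  _  = zero , here , λ ()
∣p∣<∣q∣⇒∃∈q∖p (inside ∷ p)  (inside ∷ q)  (s≤s lt) with ∣p∣<∣q∣⇒∃∈q∖p p q lt
... | x , x∈q , x∉p = suc x , there x∈q , x∉p ∘ drop-there

∃-between : ∀ {n k} (p r : Subset n) → p ⊆ r → ∣ p ∣ ≤ k → k ≤ ∣ r ∣ →
            ∃ λ q → p ⊆ q × q ⊆ r × ∣ q ∣ ≡ k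
∃-between []            []            _   _   z≤n = [] , (λ ()) , (λ ()) , refl
∃-between (inside ∷ p)  (outside ∷ r) p⊆r _   _   = contradiction (p⊆r here) λ ()
∃-between (outside ∷ p) (outside ∷ r) p⊆r p≤k k≤r with ∃-between p r (drop-∷-⊆ p⊆r) p≤k k≤r
... | q , p⊆q , q⊆r , ∣q∣≡k = outside ∷ q , s⊆s p⊆q , s⊆s q⊆r , ∣q∣≡k
∃-between (inside ∷ p)  (inside ∷ r)  p⊆r (s≤s p≤k) (s≤s k≤r)
  with ∃-between p r (drop-∷-⊆ p⊆r) p≤k k≤r
... | q , p⊆q , q⊆r , ∣q∣≡k = inside ∷ q , s⊆s p⊆q , s⊆s q⊆r , cong suc ∣q∣≡k
∃-between {k = k} (outside ∷ p) (inside ∷ r) p⊆r p≤k k≤1+r with k ≤? ∣ r ∣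
... | yes k≤r with ∃-between p r (drop-∷-⊆ p⊆r) p≤k k≤r
...   | q , p⊆q , q⊆r , ∣q∣≡k = outside ∷ q , s⊆s p⊆q , out⊆ q⊆r , ∣q∣≡k
∃-between {k = k} (outside ∷ p) (inside ∷ r) p⊆r p≤k k≤1+r | no k≰r =
  inside ∷ r , out⊆ (drop-∷-⊆ p⊆r) , ⊆-refl , ≤-antisym (≰⇒> k≰r) k≤1+r

∣r─q∣<∣r─p∣ : ∀ {n} {p q r : Subset n} → p ⊆ q → q ⊆ r → ∣ p ∣ < ∣ q ∣ → ∣ r ─ q ∣ < ∣ r ─ p ∣
∣r─q∣<∣r─p∣ {p = p} {q} {r} p⊆q q⊆r ∣p∣<∣q∣ with ∣p∣<∣q∣⇒∃∈q∖p p q ∣p∣<∣q∣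
... | x , x∈q , x∉p =
  p⊂q⇒∣p∣<∣q∣ (r─q⊆r─p , x , x∈p∧x∉q⇒x∈p─q (q⊆r x∈q) x∉p , λ x∈r─q → x∈p─q⇒x∉q r q x∈r─q x∈q)
  where
  r─q⊆r─p : r ─ q ⊆ r ─ p
  r─q⊆r─p y∈r─q = x∈p∧x∉q⇒x∈p─q (p─q⊆p r q y∈r─q) (x∈p─q⇒x∉q r q y∈r─q ∘ p⊆q)

─∩-⊆ : ∀ {n} {U V X R : Subset n} → V ⊆ U → X ⊆ R → V ─ (V ∩ R) ⊆ U ─ X
─∩-⊆ {V = V} {R = R} V⊆U X⊆R {x} x∈ =
  x∈p∧x∉q⇒x∈p─q (V⊆U x∈V) (λ x∈X → x∈p─q⇒x∉q V (V ∩ R) x∈ (x∈p∩q⁺ (x∈V , X⊆R x∈X)))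
  where
  x∈V : x ∈ V
  x∈V = p─q⊆p V (V ∩ R) x∈

anchor⊆private∪separator : ∀ {n} {U A B X Y Z : Subset n} →
                           Y ⊆ Z → (∀ {x} → x ∈ A → x ∈ B → x ∈ Z) →
                           (U ∩ A) ∩ (X ∪ Y) ⊆ (X ∩ (A ─ B)) ∪ Z
anchor⊆private∪separator {U = U} {A} {B} {X} {Y} Y⊆Z A∩B⊆Z {x} x∈
  with x∈p∩q⁻ (U ∩ A) (X ∪ Y) x∈
... | x∈U∩A , x∈X∪Y with proj₂ (x∈p∩q⁻ U A x∈U∩A) | x ∈? B | x∈p∪q⁻ X Y x∈X∪Y
...   | x∈A | yes x∈B | _        = x∈p∪q⁺ (inj₂ (A∩B⊆Z x∈A x∈B))
...   | x∈A | no x∉B  | inj₁ x∈X = x∈p∪q⁺ (inj₁ (x∈p∩q⁺ (x∈X , x∈p∧x∉q⇒x∈p─q x∈A x∉B)))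
...   | _   | no _    | inj₂ x∈Y = x∈p∪q⁺ (inj₂ (Y⊆Z x∈Y))

module _ {n} {G : Graph n} {A B : Subset n} (sep : IsSeparation G A B) where
  open IsSeparation sep

  ∉ˡ⇒∈ʳ : ∀ {x} → x ∉ A → x ∈ B
  ∉ˡ⇒∈ʳ {x} x∉A = fromInj₂ (flip contradiction x∉A) (cover x)

  separation-edge : ∀ {x y} → Adj G x y → (x ∈ A × y ∈ A) ⊎ (x ∈ B × y ∈ B)
  separation-edge {x} {y} xy with x ∈? A | y ∈? A
  ... | yes x∈A | yes y∈A = inj₁ (x∈A , y∈A)
  ... | no x∉A  | no y∉A  = inj₂ (∉ˡ⇒∈ʳ x∉A , ∉ˡ⇒∈ʳ y∉A)
  ... | yes x∈A | no y∉A with x ∈? B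
  ...   | yes x∈B = inj₂ (x∈B , ∉ˡ⇒∈ʳ y∉A)
  ...   | no x∉B  = contradiction xy
                      (noEdge x y (x∈p∧x∉q⇒x∈p─q x∈A x∉B) (x∈p∧x∉q⇒x∈p─q (∉ˡ⇒∈ʳ y∉A) y∉A))
  separation-edge {x} {y} xy | no x∉A | yes y∈A with y ∈? B
  ...   | yes y∈B = inj₂ (∉ˡ⇒∈ʳ x∉A , y∈B)
  ...   | no y∉B  = contradiction (symAdj G xy)
                      (noEdge y x (x∈p∧x∉q⇒x∈p─q y∈A y∉B) (x∈p∧x∉q⇒x∈p─q (∉ˡ⇒∈ʳ x∉A) x∉A))

module Decompositions {n : ℕ} (G : Graph n) (W : ℕ) where

  record RootedDecomposition (S U : Subset n) : Set₁ where
    field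
      tree : RootedTree
    open RootedTree tree public
    field
      bag     : Node → Subset n
      bag⊆    : ∀ t → bag t ⊆ U
      anchor  : S ⊆ bag root
      covers  : ∀ {x} → x ∈ U → ∃ λ t → x ∈ bag t
      edges   : ∀ {x y} → x ∈ U → y ∈ U → Adj G x y → ∃ λ t → x ∈ bag t × y ∈ bag t
      subtree : ∀ x → Subtree (λ t → x ∈ bag t)
      width   : ∀ t → ∣ bag t ∣ ≤ W

    anchored-subtree : ∀ {x} → (x ∈ U → x ∈ S) → ClosedUpTo (λ t → x ∈ bag t) root
    anchored-subtree {x} x∈S = closedUpTo-root (proj₂ (subtree x)) (λ {t} → anchor ∘ x∈S ∘ bag⊆ t)

  singleton : ∀ {S U} → S ⊆ U → ∣ U ∣ ≤ W → RootedDecomposition S U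
  singleton {U = U} S⊆U ∣U∣≤W = record
    { tree    = point
    ; bag     = λ _ → U
    ; bag⊆    = λ _ x∈U → x∈U
    ; anchor  = S⊆U
    ; covers  = λ x∈U → _ , x∈U
    ; edges   = λ x∈U y∈U _ → _ , x∈U , y∈U
    ; subtree = λ _ → _ , λ _ _ → inj₁ refl
    ; width   = λ _ → ∣U∣≤W }

  glue : ∀ {S U R A B} → IsSeparation G A B →
         RootedDecomposition ((U ∩ A) ∩ R) (U ∩ A) → RootedDecomposition ((U ∩ B) ∩ R) (U ∩ B) →
         R ⊆ U → ∣ R ∣ ≤ W → S ⊆ R → U ∩ (A ∩ B) ⊆ R → RootedDecomposition S U
  glue {U = U} {R = R} {A = A} {B = B} sep D₁ D₂ R⊆U ∣R∣≤W S⊆R U∩A∩B⊆R = record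
    { tree    = Join.tree D₁.tree D₂.tree
    ; bag     = bag
    ; bag⊆    = bag⊆
    ; anchor  = S⊆R
    ; covers  = covers
    ; edges   = edges
    ; subtree = subtree
    ; width   = width }
    where
    module D₁ = RootedDecomposition D₁
    module D₂ = RootedDecomposition D₂
    open Join D₁.tree D₂.tree

    bag : Node → Subset n
    bag apex    = R
    bag (inl t) = D₁.bag t
    bag (inr t) = D₂.bag t

    bag⊆ : ∀ t → bag t ⊆ U
    bag⊆ apex    = R⊆U
    bag⊆ (inl t) = p∩q⊆p U A ∘ D₁.bag⊆ t
    bag⊆ (inr t) = p∩q⊆p U B ∘ D₂.bag⊆ t

    covers : ∀ {x} → x ∈ U → ∃ λ t → x ∈ bag t
    covers {x} x∈U with IsSeparation.cover sep x
    ... | inj₁ x∈A = Product.map inl id (D₁.covers (x∈p∩q⁺ (x∈U , x∈A)))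
    ... | inj₂ x∈B = Product.map inr id (D₂.covers (x∈p∩q⁺ (x∈U , x∈B)))

    edges : ∀ {x y} → x ∈ U → y ∈ U → Adj G x y → ∃ λ t → x ∈ bag t × y ∈ bag t
    edges x∈U y∈U xy with separation-edge sep xy
    ... | inj₁ (x∈A , y∈A) =
      Product.map inl id (D₁.edges (x∈p∩q⁺ (x∈U , x∈A)) (x∈p∩q⁺ (y∈U , y∈A)) xy)
    ... | inj₂ (x∈B , y∈B) =
      Product.map inr id (D₂.edges (x∈p∩q⁺ (x∈U , x∈B)) (x∈p∩q⁺ (y∈U , y∈B)) xy)

    subtree : ∀ x → RootedTree.Subtree tree (λ t → x ∈ bag t)
    subtree x with x ∈? R | x ∈? U ∩ A
    ... | yes x∈R | _ = apex , closedUpTo-apex x∈R (D₁.anchored-subtree ∈∩R) (D₂.anchored-subtree ∈∩R)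
      where
      ∈∩R : ∀ {V} → x ∈ V → x ∈ V ∩ R
      ∈∩R x∈V = x∈p∩q⁺ (x∈V , x∈R)
    ... | no x∉R | yes x∈U∩A = inl _ , closedUpTo-inl x∉R x∉D₂ (proj₂ (D₁.subtree x))
      where
      x∉D₂ : ∀ t → x ∉ D₂.bag t
      x∉D₂ t x∈t with x∈p∩q⁻ U A x∈U∩A | x∈p∩q⁻ U B (D₂.bag⊆ t x∈t)
      ... | x∈U , x∈A | _ , x∈B = x∉R (U∩A∩B⊆R (x∈p∩q⁺ (x∈U , x∈p∩q⁺ (x∈A , x∈B))))
    ... | no x∉R | no x∉U∩A =
      inr _ , closedUpTo-inr x∉R (λ t → x∉U∩A ∘ D₁.bag⊆ t) (proj₂ (D₂.subtree x))

    width : ∀ t → ∣ bag t ∣ ≤ W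
    width apex    = ∣R∣≤W
    width (inl t) = D₁.width t
    width (inr t) = D₂.width t

  toTreeDecomposition : ∀ {S w} → W ≤ suc w → RootedDecomposition S ⊤ → TreeDecomposition G w
  toTreeDecomposition W≤1+w D = record
    { m       = size
    ; T       = graph
    ; isTree  = graph-isTree
    ; bag     = bag ∘ to
    ; covers  = λ v → index (covers ∈⊤)
    ; edges   = λ u v uv → index (edges ∈⊤ ∈⊤ uv)
    ; subtree = λ v → subtree⇒connected (subtree v)
    ; width   = λ i → ≤-trans (width (to i)) W≤1+w }
    where
    open RootedDecomposition D
    open Inverse enumeration using (to)

balanced-budget : ∀ {c a z k q} → 1 ≤ c → c * a ≤ (c ∸ 1) * q → z ≤ k → c * k + 1 ≤ q → a + z < q
balanced-budget {suc c} {a} {z} {k} {q} _ ca≤cq z≤k ck<q =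
  *-cancelˡ-< (suc c) (a + z) q $ begin-strict
  suc c * (a + z)       ≡⟨ *-distribˡ-+ (suc c) a z ⟩
  suc c * a + suc c * z ≤⟨ +-mono-≤ ca≤cq (*-monoʳ-≤ (suc c) z≤k) ⟩
  c * q + suc c * k     <⟨ +-monoʳ-< (c * q) (≤-trans (≤-reflexive (+-comm 1 _)) ck<q) ⟩
  c * q + q             ≡⟨ +-comm (c * q) q ⟩
  suc c * q             ∎
  where open ≤-Reasoning

module Construction {n : ℕ} (G : Graph n) (k c q : ℕ) (1≤c : 1 ≤ c) (ck<q : c * k + 1 ≤ q)
  (separator : (X : Subset n) → ∣ X ∣ ≡ q → Σ (Subset n) λ A → Σ (Subset n) λ B →
                 IsSeparation G A B × Balanced c X A B × (order A B ≤ k)) where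

  open Decompositions G (q + k)

  split : ∀ {S U} → S ⊆ U → ∣ S ∣ < q → q ≤ ∣ U ∣ →
          (∀ {S′ U′} → ∣ U′ ─ S′ ∣ < ∣ U ─ S ∣ → S′ ⊆ U′ → ∣ S′ ∣ < q → RootedDecomposition S′ U′) →
          RootedDecomposition S U
  split {S} {U} S⊆U ∣S∣<q q≤∣U∣ recurse with ∃-between S U S⊆U (<⇒≤ ∣S∣<q) q≤∣U∣
  ... | X , S⊆X , X⊆U , ∣X∣≡q with separator X ∣X∣≡q
  ... | A , B , sep , (balancedˡ , balancedʳ) , ∣A∩B∣≤k =
    glue sep (child balancedˡ λ x∈A x∈B → x∈p∩q⁺ (x∈A , x∈B))
             (child balancedʳ λ x∈B x∈A → x∈p∩q⁺ (x∈A , x∈B))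
             R⊆U ∣R∣≤q+k (⊆-trans S⊆X (p⊆p∪q _)) (q⊆p∪q X _)
    where
    R : Subset n
    R = X ∪ (U ∩ (A ∩ B))

    R⊆U : R ⊆ U
    R⊆U x∈R = [ X⊆U , p∩q⊆p U (A ∩ B) ]′ (x∈p∪q⁻ X _ x∈R)

    ∣R∣≤q+k : ∣ R ∣ ≤ q + k
    ∣R∣≤q+k = ≤-trans (∣p∪q∣≤∣p∣+∣q∣ X _)
                      (+-mono-≤ (≤-reflexive ∣X∣≡q) (≤-trans (∣p∩q∣≤∣q∣ U _) ∣A∩B∣≤k))

    progress : ∀ {V} → V ⊆ U → ∣ V ─ (V ∩ R) ∣ < ∣ U ─ S ∣
    progress V⊆U = ≤-<-trans (p⊆q⇒∣p∣≤∣q∣ (─∩-⊆ {R = R} V⊆U (p⊆p∪q (U ∩ (A ∩ B)))))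
                             (∣r─q∣<∣r─p∣ S⊆X X⊆U (subst (∣ S ∣ <_) (sym ∣X∣≡q) ∣S∣<q))

    small-anchor : ∀ {A′ B′} → c * ∣ X ∩ (A′ ─ B′) ∣ ≤ (c ∸ 1) * ∣ X ∣ →
                   (∀ {x} → x ∈ A′ → x ∈ B′ → x ∈ A ∩ B) → ∣ (U ∩ A′) ∩ R ∣ < q
    small-anchor {A′} {B′} balanced A′∩B′⊆A∩B = begin-strict
      ∣ (U ∩ A′) ∩ R ∣                 ≤⟨ p⊆q⇒∣p∣≤∣q∣ anchor⊆ ⟩
      ∣ (X ∩ (A′ ─ B′)) ∪ (A ∩ B) ∣    ≤⟨ ∣p∪q∣≤∣p∣+∣q∣ (X ∩ (A′ ─ B′)) (A ∩ B) ⟩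
      ∣ X ∩ (A′ ─ B′) ∣ + ∣ A ∩ B ∣    <⟨ balanced-budget 1≤c balanced′ ∣A∩B∣≤k ck<q ⟩
      q                                ∎
      where
      open ≤-Reasoning

      anchor⊆ : (U ∩ A′) ∩ R ⊆ (X ∩ (A′ ─ B′)) ∪ (A ∩ B)
      anchor⊆ = anchor⊆private∪separator (p∩q⊆q U (A ∩ B)) A′∩B′⊆A∩B

      balanced′ : c * ∣ X ∩ (A′ ─ B′) ∣ ≤ (c ∸ 1) * q
      balanced′ = subst (λ x → c * ∣ X ∩ (A′ ─ B′) ∣ ≤ (c ∸ 1) * x) ∣X∣≡q balanced

    child : ∀ {A′ B′} → c * ∣ X ∩ (A′ ─ B′) ∣ ≤ (c ∸ 1) * ∣ X ∣ →
            (∀ {x} → x ∈ A′ → x ∈ B′ → x ∈ A ∩ B) → RootedDecomposition ((U ∩ A′) ∩ R) (U ∩ A′)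
    child balanced A′∩B′⊆A∩B =
      recurse (progress (p∩q⊆p U _)) (p∩q⊆p _ R) (small-anchor balanced A′∩B′⊆A∩B)

  decompose : ∀ {S U} → Acc _<_ ∣ U ─ S ∣ → S ⊆ U → ∣ S ∣ < q → RootedDecomposition S U
  decompose {U = U} (acc smaller) S⊆U ∣S∣<q with ∣ U ∣ ≤? q + k
  ... | yes small = singleton S⊆U small
  ... | no large  = split S⊆U ∣S∣<q (≤-trans (m≤m+n q k) (<⇒≤ (≰⇒> large))) (decompose ∘ smaller)

lemma9 : (k c q : ℕ) → 1 ≤ k → 2 ≤ c → c * k + 1 ≤ q →
    {n : ℕ} (G : Graph n) →
    ((X : Subset n) → ∣ X ∣ ≡ q →
      Σ (Subset n) λ A → Σ (Subset n) λ B →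
        IsSeparation G A B × Balanced c X A B × (order A B ≤ k)) →
    TwAtMost G (q + k ∸ 1)
lemma9 k c q _ 2≤c ck<q {n} G separator =
  toTreeDecomposition (m≤n+m∸n (q + k) 1) (decompose (<-wellFounded _) (⊆-min ⊤) ∣⊥∣<q)
  where
  open Decompositions G (q + k)
  open Construction G k c q (≤-trans (n≤1+n 1) 2≤c) ck<q separator

  ∣⊥∣<q : ∣ ⊥ {n} ∣ < q
  ∣⊥∣<q = subst (_< q) (sym (∣⊥∣≡0 n)) (≤-trans (m≤n+m 1 (c * k)) ck<q)
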